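{- Let $\mathcal A=(\{0,1\};\cdot)$ where $x\cdot y=\neg x\wedge\neg y$. Then $\mathcal A$ has bounded relational width, i.e. there exist $1\le k\le l$ such that $\mathcal A$ has relational width $(k,l)$.
   Context: Homomorphisms commute with operations. $\mathrm{graph}(\mathcal A)$ is the relational structure on the same domain with, for each $k$-ary operation $f$, the relation $\{(a_1,\dots,a_k,f(a_1,\dots,a_k))\}$ (plus any relations of the structure). Let $X,A$ be sets, $k$ an integer, and $\mathcal P=(P_K)$ indexed by $K\subseteq X$ with $|K|\le k$, $P_K\subseteq A^K$. For $L\subseteq X$ and $C\subseteq A^L$, $\mathcal P$ has the $k$-forth property for $C$ if for every $K\subseteq L$, $|K|\le k$, and $f\in P_K$ there is $g\in C$ with $g|_K=f$ and $g|_{K'}\in P_{K'}$ for all $K'\subseteq L$ with $|K'|\le k$. For $l\ge k$, $\mathcal P$ is a $(k,l)$-system if it has the $k$-forth property for $A^L$ for all $L\subseteq X$ with $|L|\le l$; non-trivial if no $P_K$ is empty; compatible with a structure $\mathcal X$ (domain $X$) if it also has the $k$-forth property for $\{g:L\to A\mid(g(y_1),\dots,g(y_n))\in R^{\mathrm{graph}(\mathcal A)}\}$ for each relation $R$ of the graph signature and each $(y_1,\dots,y_n)\in R^{\mathrm{graph}(\mathcal X)}$, $L=\{y_1,\dots,y_n\}$. $\mathcal A$ has relational width $(k,l)$ if every finite structure $\mathcal X$ of the same signature with a non-trivial compatible $(k,l)$-system has a homomorphism to $\mathcal A$. -}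

module Defs where

open import Data.Nat using (ℕ; _≤_)
open import Data.Bool using (Bool; true; false; not; _∧_)
open import Data.Fin using (Fin)
open import Data.Fin.Subset using (Subset; _∈_; _⊆_; ∣_∣; ⁅_⁆; _∪_)
open import Data.Product using (Σ; ∃; _×_; _,_)
open import Data.Unit using (⊤)
open import Relation.Binary.PropositionalEquality using (_≡_)

-- The operation of 𝒜 = ({0,1}; ·) with x · y = ¬x ∧ ¬y  (0 = false, 1 = true).
nor : Bool → Bool → Bool
nor x y = not x ∧ not y

-- A finite structure 𝒳 of the same signature (one binary operation) has
-- domain Fin n and an operation op : Fin n → Fin n → Fin n.

-- An element of A^K (K ⊆ X) is represented by a total map Fin n → Bool,
-- of which only the values on K matter.  A family 𝒫 = (P_K) is a predicate
-- P K f, required to depend only on the values of f on K (Respects).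
Family : ℕ → Set₁
Family n = Subset n → (Fin n → Bool) → Set

AgreeOn : ∀ {n} → Subset n → (Fin n → Bool) → (Fin n → Bool) → Set
AgreeOn K f g = ∀ x → x ∈ K → f x ≡ g x

Respects : ∀ {n} → Family n → Set
Respects {n} P = ∀ (K : Subset n) f g → AgreeOn K f g → P K f → P K g

Forth : ∀ {n} → ℕ → Family n → Subset n → ((Fin n → Bool) → Set) → Set
Forth {n} k P L C =
  ∀ (K : Subset n) → K ⊆ L → ∣ K ∣ ≤ k → ∀ f → P K f →
  Σ (Fin n → Bool) λ g → C g × AgreeOn K g f ×
    (∀ (K′ : Subset n) → K′ ⊆ L → ∣ K′ ∣ ≤ k → P K′ g)

IsSystem : ∀ {n} → ℕ → ℕ → Family n → Set
IsSystem {n} k l P = ∀ (L : Subset n) → ∣ L ∣ ≤ l → Forth k P L (λ _ → ⊤)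

NonTrivial : ∀ {n} → ℕ → Family n → Set
NonTrivial {n} k P = ∀ (K : Subset n) → ∣ K ∣ ≤ k → ∃ λ f → P K f

-- compatibility with 𝒳: the only relation of graph(𝒳) is
-- {(y₁,y₂,op y₁ y₂)}, and the corresponding relation of graph(𝒜) is
-- {(a,b,nor a b)}.
Compatible : ∀ {n} → ℕ → (Fin n → Fin n → Fin n) → Family n → Set
Compatible {n} k op P =
  ∀ (y₁ y₂ : Fin n) →
  Forth k P (⁅ y₁ ⁆ ∪ ⁅ y₂ ⁆ ∪ ⁅ op y₁ y₂ ⁆)
            (λ g → g (op y₁ y₂) ≡ nor (g y₁) (g y₂))

Hom : ∀ {n} → (Fin n → Fin n → Fin n) → (Fin n → Bool) → Set
Hom {n} op h = ∀ (x y : Fin n) → h (op x y) ≡ nor (h x) (h y)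

RelWidthNor : ℕ → ℕ → Set₁
RelWidthNor k l =
  ∀ (n : ℕ) (op : Fin n → Fin n → Fin n) (P : Family n) →
  Respects P → NonTrivial k P → IsSystem k l P → Compatible k op P →
  ∃ λ (h : Fin n → Bool) → Hom op h

module Submission where

-- An element a is an anchor for a set Y of elements if the system allows a = 1
-- and, for every y ∈ Y, the pair system P_{a,y} determines the value of y once
-- a = 1.  Some element c or c·c is an anchor for ∅, since c·c = ¬c.  Anchors
-- extend one element at a time: if b is a value of x compatible with a = 1,
-- then (a·a)·t, with t = x for b = 0 and t = x·x for b = 1, evaluates to 1
-- exactly when a = 1 and x = b, so it is an anchor for Y ∪ {x}.  Checking this
-- involves seven elements and relations of arity at most three, whence the
-- width (3,7).  An anchor for the whole domain makes y ↦ (determined value of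
-- y) a homomorphism.

open import Defs
open import Data.Nat using (ℕ; zero; suc; _≤_; _+_; z≤n; s≤s)
open import Data.Nat.Properties using (≤-refl; ≤-trans; ≤-reflexive; +-suc; +-mono-≤; +-monoʳ-≤)
open import Data.Bool using (Bool; true; false; not; _xor_)
open import Data.Bool.Properties using (∧-idem; xor-same)
open import Data.Fin as Fin using (Fin)
open import Data.Fin.Subset using (Subset; _∈_; _⊆_; ∣_∣; ⁅_⁆; _∪_; ⊥; inside; outside)
open import Data.Fin.Subset.Properties
  using (∉⊥; ∣⊥∣≡0; ∣⁅x⁆∣≡1; ∣p∣≤∣x∷p∣; x∈⁅x⁆; x∈⁅y⁆⇒x≡y; x∈p∪q⁻; p⊆p∪q; q⊆p∪q)
open import Data.Vec using ([]; _∷_)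
open import Data.List using (List; []; _∷_; length; allFin)
open import Data.List.Relation.Unary.All as All using (All; []; _∷_)
open import Data.List.Relation.Unary.Any using (here; there)
open import Data.List.Membership.Propositional using () renaming (_∈_ to _∈ₗ_)
open import Data.List.Membership.Propositional.Properties using (∈-allFin)
open import Data.Product using (Σ; ∃; _×_; _,_; proj₁; proj₂)
open import Data.Sum using (inj₁; inj₂)
open import Relation.Nullary using (contradiction)
open import Relation.Binary.PropositionalEquality
  using (_≡_; refl; sym; trans; cong; cong₂; subst; module ≡-Reasoning)

∣p∪q∣≤∣p∣+∣q∣ : ∀ {n} (p q : Subset n) → ∣ p ∪ q ∣ ≤ ∣ p ∣ + ∣ q ∣
∣p∪q∣≤∣p∣+∣q∣ [] [] = z≤n
∣p∪q∣≤∣p∣+∣q∣ (inside ∷ p) (t ∷ q) =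
  s≤s (≤-trans (∣p∪q∣≤∣p∣+∣q∣ p q) (+-monoʳ-≤ ∣ p ∣ (∣p∣≤∣x∷p∣ t q)))
∣p∪q∣≤∣p∣+∣q∣ (outside ∷ p) (inside ∷ q) =
  ≤-trans (s≤s (∣p∪q∣≤∣p∣+∣q∣ p q)) (≤-reflexive (sym (+-suc ∣ p ∣ ∣ q ∣)))
∣p∪q∣≤∣p∣+∣q∣ (outside ∷ p) (outside ∷ q) = ∣p∪q∣≤∣p∣+∣q∣ p q

-- The singleton clause makes ⟦ y₁ ∷ y₂ ∷ op y₁ y₂ ∷ [] ⟧ definitionally the
-- set occurring in Compatible.
⟦_⟧ : ∀ {n} → List (Fin n) → Subset n
⟦ [] ⟧ = ⊥
⟦ x ∷ [] ⟧ = ⁅ x ⁆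
⟦ x ∷ y ∷ ys ⟧ = ⁅ x ⁆ ∪ ⟦ y ∷ ys ⟧

∣⟦⟧∣≤length : ∀ {n} (xs : List (Fin n)) → ∣ ⟦ xs ⟧ ∣ ≤ length xs
∣⟦⟧∣≤length {n} [] = ≤-reflexive (∣⊥∣≡0 n)
∣⟦⟧∣≤length (x ∷ []) = ≤-reflexive (∣⁅x⁆∣≡1 x)
∣⟦⟧∣≤length (x ∷ y ∷ ys) =
  ≤-trans (∣p∪q∣≤∣p∣+∣q∣ ⁅ x ⁆ ⟦ y ∷ ys ⟧)
          (+-mono-≤ (≤-reflexive (∣⁅x⁆∣≡1 x)) (∣⟦⟧∣≤length (y ∷ ys)))

∈ₗ⇒∈⟦⟧ : ∀ {n} {x : Fin n} {xs} → x ∈ₗ xs → x ∈ ⟦ xs ⟧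
∈ₗ⇒∈⟦⟧ {xs = _ ∷ []} (here refl) = x∈⁅x⁆ _
∈ₗ⇒∈⟦⟧ {xs = _ ∷ y ∷ ys} (here refl) = p⊆p∪q ⟦ y ∷ ys ⟧ (x∈⁅x⁆ _)
∈ₗ⇒∈⟦⟧ {xs = x ∷ _ ∷ _} (there x∈xs) = q⊆p∪q ⁅ x ⁆ _ (∈ₗ⇒∈⟦⟧ x∈xs)

⟦⟧-mono : ∀ {n} {xs ys : List (Fin n)} → All (_∈ₗ xs) ys → ⟦ ys ⟧ ⊆ ⟦ xs ⟧
⟦⟧-mono {ys = []} [] z∈⊥ = contradiction z∈⊥ ∉⊥
⟦⟧-mono {ys = y ∷ []} (y∈ ∷ []) z∈ = subst (_∈ _) (sym (x∈⁅y⁆⇒x≡y y z∈)) (∈ₗ⇒∈⟦⟧ y∈)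
⟦⟧-mono {ys = y ∷ _ ∷ _} (y∈ ∷ ys⊆) z∈ with x∈p∪q⁻ ⁅ y ⁆ _ z∈
... | inj₁ z∈⁅y⁆ = ⟦⟧-mono (y∈ ∷ []) z∈⁅y⁆
... | inj₂ z∈ys = ⟦⟧-mono ys⊆ z∈ys

nor-self : ∀ p → nor p p ≡ not p
nor-self p = ∧-idem (not p)

nor-not-xor-true : ∀ p b q → nor (not p) (b xor q) ≡ true → p ≡ true × q ≡ b
nor-not-xor-true true false false _ = refl , refl
nor-not-xor-true true true true _ = refl , refl
nor-not-xor-true true false true ()
nor-not-xor-true true true false ()
nor-not-xor-true false _ _ ()

module Anchors {n : ℕ} (op : Fin n → Fin n → Fin n) (P : Family n)
  (nt : NonTrivial 3 P) (sys : IsSystem 3 7 P) (comp : Compatible 3 op P) where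

  record Consistent (xs : List (Fin n)) (g : Fin n → Bool) : Set where
    constructor consistent
    field on : ∀ K → K ⊆ ⟦ xs ⟧ → ∣ K ∣ ≤ 3 → P K g

  extend : ∀ xs {ys f} → length xs ≤ 7 → All (_∈ₗ xs) ys → length ys ≤ 3 → P ⟦ ys ⟧ f →
           ∃ λ g → (∀ {z} → z ∈ₗ ys → g z ≡ f z) × Consistent xs g
  extend xs {ys} |xs|≤7 ys⊆xs |ys|≤3 Pf
    with sys ⟦ xs ⟧ (≤-trans (∣⟦⟧∣≤length xs) |xs|≤7) ⟦ ys ⟧ (⟦⟧-mono ys⊆xs)
             (≤-trans (∣⟦⟧∣≤length ys) |ys|≤3) _ Pf
  ... | g , _ , g≈f , g-on = g , (λ z∈ys → g≈f _ (∈ₗ⇒∈⟦⟧ z∈ys)) , consistent g-on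

  consistent-at : ∀ {xs ys g} → Consistent xs g → All (_∈ₗ xs) ys → length ys ≤ 3 → P ⟦ ys ⟧ g
  consistent-at {ys = ys} (consistent g-on) ys⊆xs |ys|≤3 =
    g-on ⟦ ys ⟧ (⟦⟧-mono ys⊆xs) (≤-trans (∣⟦⟧∣≤length ys) |ys|≤3)

  consistent-op : ∀ {xs g y₁ y₂} → Consistent xs g → All (_∈ₗ xs) (y₁ ∷ y₂ ∷ op y₁ y₂ ∷ []) →
                  g (op y₁ y₂) ≡ nor (g y₁) (g y₂)
  consistent-op {g = g} {y₁} {y₂} g-cons ys⊆xs
    with comp y₁ y₂ _ (λ z∈ → z∈) (∣⟦⟧∣≤length (y₁ ∷ y₂ ∷ op y₁ y₂ ∷ []))
              g (consistent-at g-cons ys⊆xs ≤-refl)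
  ... | g′ , g′-op , g′≈g , _ = begin
    g (op y₁ y₂)         ≡⟨ sym (agree (there (there (here refl)))) ⟩
    g′ (op y₁ y₂)        ≡⟨ g′-op ⟩
    nor (g′ y₁) (g′ y₂)  ≡⟨ cong₂ nor (agree (here refl)) (agree (there (here refl))) ⟩
    nor (g y₁) (g y₂)    ∎
    where
    open ≡-Reasoning
    agree : ∀ {z} → z ∈ₗ y₁ ∷ y₂ ∷ op y₁ y₂ ∷ [] → g′ z ≡ g z
    agree z∈ = g′≈g _ (∈ₗ⇒∈⟦⟧ z∈)

  Realizable : Fin n → Set
  Realizable a = ∃ λ f → P ⁅ a ⁆ f × f a ≡ true

  Forces : Fin n → Fin n → Bool → Set
  Forces a y v = ∀ f → P ⟦ a ∷ y ∷ [] ⟧ f → f a ≡ true → f y ≡ v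

  Anchor : List (Fin n) → Fin n → Set
  Anchor ys a = Realizable a × All (λ y → ∃ (Forces a y)) ys

  extend-realizing : ∀ {a} xs → length (a ∷ xs) ≤ 7 → Realizable a →
                     ∃ λ g → g a ≡ true × Consistent (a ∷ xs) g
  extend-realizing xs |a∷xs|≤7 (f , Pf , fa)
    with extend (_ ∷ xs) |a∷xs|≤7 (here refl ∷ []) (s≤s z≤n) Pf
  ... | g , g≈f , g-cons = g , trans (g≈f (here refl)) fa , g-cons

  forced-value : ∀ {a xs g y v} → Consistent (a ∷ xs) g → g a ≡ true → y ∈ₗ a ∷ xs →
                 Forces a y v → g y ≡ v
  forced-value g-cons ga y∈ a-forces-y =
    a-forces-y _ (consistent-at g-cons (here refl ∷ y∈ ∷ []) (s≤s (s≤s z≤n))) ga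

  differs : Bool → Fin n → Fin n
  differs false x = x
  differs true x = op x x

  pin : Fin n → Fin n → Bool → Fin n
  pin a x b = op (op a a) (differs b x)

  frame : Fin n → Fin n → Fin n → List (Fin n)
  frame a x y = a ∷ y ∷ op a a ∷ x ∷ op x x ∷ op (op a a) x ∷ op (op a a) (op x x) ∷ []

  differs∈frame : ∀ a x y b → differs b x ∈ₗ frame a x y
  differs∈frame a x y false = there (there (there (here refl)))
  differs∈frame a x y true = there (there (there (there (here refl))))

  pin∈frame : ∀ a x y b → pin a x b ∈ₗ frame a x y
  pin∈frame a x y false = there (there (there (there (there (here refl)))))
  pin∈frame a x y true = there (there (there (there (there (there (here refl))))))

  pin-value : ∀ {a x y g} → Consistent (frame a x y) g → ∀ b →
              g (pin a x b) ≡ nor (not (g a)) (b xor g x)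
  pin-value {a} {x} {y} {g} g-cons b = begin
    g (pin a x b)
      ≡⟨ consistent-op g-cons (a·a∈ ∷ differs∈frame a x y b ∷ pin∈frame a x y b ∷ []) ⟩
    nor (g (op a a)) (g (differs b x))  ≡⟨ cong₂ nor a·a-value (differs-value b) ⟩
    nor (not (g a)) (b xor g x)         ∎
    where
    open ≡-Reasoning
    a·a∈ = there (there (here refl))
    a·a-value : g (op a a) ≡ not (g a)
    a·a-value = trans (consistent-op g-cons (here refl ∷ here refl ∷ a·a∈ ∷ [])) (nor-self (g a))
    differs-value : ∀ b → g (differs b x) ≡ b xor g x
    differs-value false = refl
    differs-value true =
      trans (consistent-op g-cons (x∈ ∷ x∈ ∷ differs∈frame a x y true ∷ [])) (nor-self (g x))
      where x∈ = differs∈frame a x y false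

  pin-true⁻ : ∀ {a x y g} → Consistent (frame a x y) g → ∀ b → g (pin a x b) ≡ true →
              g a ≡ true × g x ≡ b
  pin-true⁻ g-cons b g-pin =
    nor-not-xor-true _ b _ (trans (sym (pin-value g-cons b)) g-pin)

  pin-true⁺ : ∀ {a x y g} → Consistent (frame a x y) g → g a ≡ true → g (pin a x (g x)) ≡ true
  pin-true⁺ {a} {x} {g = g} g-cons ga = begin
    g (pin a x (g x))                    ≡⟨ pin-value g-cons (g x) ⟩
    nor (not (g a)) (g x xor g x)        ≡⟨ cong₂ (λ p q → nor (not p) q) ga (xor-same (g x)) ⟩
    true                                 ∎
    where open ≡-Reasoning

  pin-forces : ∀ a x b y → ∀ f → P ⟦ pin a x b ∷ y ∷ [] ⟧ f → f (pin a x b) ≡ true →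
               ∃ λ g → Consistent (frame a x y) g × g y ≡ f y × g a ≡ true × g x ≡ b
  pin-forces a x b y f Pf f-pin
    with extend (frame a x y) ≤-refl (pin∈frame a x y b ∷ there (here refl) ∷ []) (s≤s (s≤s z≤n)) Pf
  ... | g , g≈f , g-cons =
    let ga , gx = pin-true⁻ g-cons b (trans (g≈f (here refl)) f-pin)
    in g , g-cons , g≈f (there (here refl)) , ga , gx

  anchor-[] : Fin n → ∃ (Anchor [])
  anchor-[] c with nt ⁅ c ⁆ (≤-trans (≤-reflexive (∣⁅x⁆∣≡1 c)) (s≤s z≤n))
  ... | f , Pf with f c in fc
  ... | true = c , (f , Pf , fc) , []
  ... | false
    with extend (c ∷ op c c ∷ []) (s≤s (s≤s z≤n)) (here refl ∷ []) (s≤s z≤n) Pf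
  ... | g , g≈f , g-cons = op c c , (g , P-c·c , g-c·c) , []
    where
    P-c·c : P ⁅ op c c ⁆ g
    P-c·c = consistent-at g-cons (there (here refl) ∷ []) (s≤s z≤n)
    g-c·c : g (op c c) ≡ true
    g-c·c = begin
      g (op c c)  ≡⟨ consistent-op g-cons (here refl ∷ here refl ∷ there (here refl) ∷ []) ⟩
      nor (g c) (g c) ≡⟨ nor-self (g c) ⟩
      not (g c)   ≡⟨ cong not (trans (g≈f (here refl)) fc) ⟩
      true        ∎
      where open ≡-Reasoning

  anchor-∷ : ∀ {ys a} x → Anchor ys a → ∃ (Anchor (x ∷ ys))
  anchor-∷ {a = a} x (a-realizable , forced) with extend-realizing _ ≤-refl a-realizable
  ... | g , ga , g-cons =
    pin a x b , (g , P-pin , pin-true⁺ g-cons ga) , (b , forces-x) ∷ All.map forces-old forced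
    where
    b = g x
    P-pin : P ⁅ pin a x b ⁆ g
    P-pin = consistent-at g-cons (pin∈frame a x x b ∷ []) (s≤s z≤n)
    forces-x : Forces (pin a x b) x b
    forces-x f Pf f-pin =
      let _ , _ , g′x≡fx , _ , g′x≡b = pin-forces a x b x f Pf f-pin
      in trans (sym g′x≡fx) g′x≡b
    forces-old : ∀ {y} → ∃ (Forces a y) → ∃ (Forces (pin a x b) y)
    forces-old (v , a-forces-y) = v , λ f Pf f-pin →
      let _ , g′-cons , g′y≡fy , g′a , _ = pin-forces a x b _ f Pf f-pin
      in trans (sym g′y≡fy) (forced-value g′-cons g′a (there (here refl)) a-forces-y)

  anchor : Fin n → ∀ ys → ∃ (Anchor ys)
  anchor c [] = anchor-[] c
  anchor c (x ∷ ys) = anchor-∷ x (proj₂ (anchor c ys))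

  anchor⇒hom : ∀ {a} → Anchor (allFin n) a → ∃ (Hom op)
  anchor⇒hom {a} (a-realizable , forced) = h , hom
    where
    h : Fin n → Bool
    h y = proj₁ (All.lookup forced (∈-allFin y))
    hom : Hom op h
    hom x y with extend-realizing (x ∷ y ∷ op x y ∷ []) (s≤s (s≤s (s≤s (s≤s z≤n)))) a-realizable
    ... | g , ga , g-cons = begin
      h (op x y)       ≡⟨ sym (g≡h x·y∈) ⟩
      g (op x y)       ≡⟨ consistent-op g-cons (x∈ ∷ y∈ ∷ x·y∈ ∷ []) ⟩
      nor (g x) (g y)  ≡⟨ cong₂ nor (g≡h x∈) (g≡h y∈) ⟩
      nor (h x) (h y)  ∎
      where
      open ≡-Reasoning
      x∈ = there (here refl)
      y∈ = there (there (here refl))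
      x·y∈ = there (there (there (here refl)))
      g≡h : ∀ {z} → z ∈ₗ a ∷ x ∷ y ∷ op x y ∷ [] → g z ≡ h z
      g≡h {z} z∈ = forced-value g-cons ga z∈ (proj₂ (All.lookup forced (∈-allFin z)))

relationalWidth-3-7 : RelWidthNor 3 7
relationalWidth-3-7 zero op P _ nt sys comp = (λ ()) , (λ ())
relationalWidth-3-7 (suc m) op P _ nt sys comp =
  anchor⇒hom (proj₂ (anchor Fin.zero (allFin (suc m))))
  where open Anchors op P nt sys comp

proposition36 : Σ ℕ λ k → Σ ℕ λ l → (1 ≤ k) × (k ≤ l) × RelWidthNor k l
proposition36 = 3 , 7 , s≤s z≤n , s≤s (s≤s (s≤s z≤n)) , relationalWidth-3-7
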